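{- Let $\mathcal{P}\subseteq\widehat{\mathcal{G}}_2$ be the closure of the set of finite rooted paths, with the metric $\rho$. Let $\overline{\mathbb{N}}=\mathbb{N}\cup\{\infty\}$, let $\widetilde{\mathcal{P}}=\{(x,y)\in\overline{\mathbb{N}}^2: x\le y\}$, and define $\tilde\rho((x,y),(x',y'))=\frac{1}{1+r}$ (with the convention $\frac{1}{1+\infty}=0$) where $r=\infty$ if $x=x'$ and $y=y'$; $r=\min\{x,x'\}$ if $x\ne x'$ and $y=y'$; $r=\min\{y,y'\}$ if $x=x'$ and $y\ne y'$; and $r=\min\{x,x',y,y'\}$ if $x\ne x'$ and $y\ne y'$. Then the metric space $(\mathcal{P},\rho)$ is isometric to $(\widetilde{\mathcal{P}},\tilde\rho)$.
   Context: All graphs are simple; $\mathbb{N}=\{0,1,2,\dots\}$. A rooted graph $(G,o)$ has $o\in V(G)$; isomorphisms of rooted graphs map root to root; $[G,o]$ is the isomorphism class. $\widehat{\mathcal{G}}_2$ is the set of isomorphism classes of connected rooted graphs of maximal degree at most $2$, with metric $\rho([G,o],[G',o'])=0$ if equal and otherwise $1/(1+r)$, where $r=\sup\{s\in\mathbb{N}:[B_G(o,s),o]=[B_{G'}(o',s),o']\}$ and $B_G(o,s)$ is the subgraph induced by vertices at graph distance $\le s$ from $o$. A finite rooted path is $[P_k,o]$ where $P_k$ is the path with $k\ge1$ vertices and $o\in V(P_k)$. The closure $\mathcal{P}$ consists of the finite rooted paths, the semi-infinite rooted paths (the subgraph of the integer line induced by $[N,\infty)\cap\mathbb{Z}$,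 $N\le0$, rooted at $0$), and the bi-infinite path (integers, consecutive ones adjacent). -}

module Defs where

open import Data.Nat using (ℕ; zero; suc; _≤_)
open import Data.Nat.Properties using (_≟_)
import Data.Nat as ℕ
open import Data.Integer as ℤ using (ℤ; +_)
open import Data.Fin using (Fin; toℕ)
open import Data.Rational using (ℚ; _/_; 0ℚ)
open import Data.Product using (Σ; ∃; _×_; _,_; proj₁; proj₂)
open import Data.Sum using (_⊎_)
open import Data.Bool using (Bool; true; false)
open import Relation.Nullary using (¬_; yes; no)
open import Relation.Binary.PropositionalEquality using (_≡_)

record RGraph : Set₁ where
  field
    V    : Set
    Adj  : V → V → Set
    root : V
open RGraph public

_⇔_ : Set → Set → Set
A ⇔ B = (A → B) × (B → A)

data Walk (G : RGraph) : V G → V G → ℕ → Set where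
  here : ∀ {u} → Walk G u u zero
  step : ∀ {u w v n} → Adj G u w → Walk G w v n → Walk G u v (suc n)

Within : (G : RGraph) → ℕ → V G → Set
Within G s v = ∃ λ n → n ≤ s × Walk G (root G) v n

_≅ʳ_ : RGraph → RGraph → Set
G ≅ʳ H = Σ (V G → V H) λ f → Σ (V H → V G) λ g →
  (∀ v → g (f v) ≡ v) × (∀ w → f (g w) ≡ w) × (f (root G) ≡ root H) ×
  (∀ u v → Adj G u v ⇔ Adj H (f u) (f v))

-- [B_G(root,s),root] ≅ [B_H(root,s),root]: rooted isomorphism of the
-- induced subgraphs on the balls of radius s (written out literally).
BallIso : ℕ → RGraph → RGraph → Set
BallIso s G H = Σ (V G → V H) λ f → Σ (V H → V G) λ g →
  (∀ v → Within G s v → Within H s (f v)) ×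
  (∀ w → Within H s w → Within G s (g w)) ×
  (∀ v → Within G s v → g (f v) ≡ v) ×
  (∀ w → Within H s w → f (g w) ≡ w) ×
  (f (root G) ≡ root H) ×
  (∀ u v → Within G s u → Within G s v → Adj G u v ⇔ Adj H (f u) (f v))

data ℕ∞ : Set where
  fin : ℕ → ℕ∞
  ∞   : ℕ∞

data _≤∞_ : ℕ∞ → ℕ∞ → Set where
  fin≤fin : ∀ {m n} → m ≤ n → fin m ≤∞ fin n
  _≤∞∞    : ∀ x → x ≤∞ ∞

min∞ : ℕ∞ → ℕ∞ → ℕ∞
min∞ (fin m) (fin n) = fin (ℕ._⊓_ m n)
min∞ (fin m) ∞ = fin m
min∞ ∞ y = y

_≟∞_ : ℕ∞ → ℕ∞ → Bool
fin m ≟∞ fin n with m ≟ n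
... | yes _ = true
... | no _  = false
fin _ ≟∞ ∞ = false
∞ ≟∞ fin _ = false
∞ ≟∞ ∞ = true

IsSup : (ℕ → Set) → ℕ∞ → Set
IsSup S r = (∀ s → S s → fin s ≤∞ r) ×
            (∀ u → (∀ s → S s → fin s ≤∞ u) → r ≤∞ u)

inv1+ : ℕ∞ → ℚ
inv1+ (fin n) = + 1 / suc n
inv1+ ∞ = 0ℚ

-- The metric ρ on rooted graph classes, as a relation "ρ([G],[H]) = q"

Ρ : RGraph → RGraph → ℚ → Set
Ρ G H q = (G ≅ʳ H × q ≡ 0ℚ) ⊎
          (¬ (G ≅ʳ H) × ∃ λ r → IsSup (λ s → BallIso s G H) r × q ≡ inv1+ r)

-- The rooted paths making up 𝒫 (each element of 𝒫 is the class of one)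

-- finite path P_k (vertices 0..k-1), k ≥ 1 forced by the root o : Fin k
PathFin : (k : ℕ) → Fin k → RGraph
PathFin k o = record
  { V = Fin k
  ; Adj = λ i j → (suc (toℕ i) ≡ toℕ j) ⊎ (suc (toℕ j) ≡ toℕ i)
  ; root = o }

-- semi-infinite path [N,∞)∩ℤ rooted at 0, with m = -N; vertex n ∈ ℕ
-- stands for the integer n - m (an isomorphic copy)
PathSemi : ℕ → RGraph
PathSemi m = record
  { V = ℕ
  ; Adj = λ i j → (suc i ≡ j) ⊎ (suc j ≡ i)
  ; root = m }

PathBi : RGraph
PathBi = record
  { V = ℤ
  ; Adj = λ i j → (i ℤ.+ + 1 ≡ j) ⊎ (j ℤ.+ + 1 ≡ i)
  ; root = + 0 }

data PathCode : Set where
  finP  : (k : ℕ) → Fin k → PathCode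
  semiP : ℕ → PathCode
  biP   : PathCode

⟦_⟧ : PathCode → RGraph
⟦ finP k o ⟧ = PathFin k o
⟦ semiP m ⟧ = PathSemi m
⟦ biP ⟧ = PathBi

P̃ : Set
P̃ = Σ (ℕ∞ × ℕ∞) λ xy → proj₁ xy ≤∞ proj₂ xy

r̃ : ℕ∞ → ℕ∞ → ℕ∞ → ℕ∞ → ℕ∞
r̃ x y x' y' with x ≟∞ x' | y ≟∞ y'
... | true  | true  = ∞
... | false | true  = min∞ x x'
... | true  | false = min∞ y y'
... | false | false = min∞ (min∞ x x') (min∞ y y')

ρ̃ : P̃ → P̃ → ℚ
ρ̃ ((x , y) , _) ((x' , y') , _) = inv1+ (r̃ x y x' y')

-- A rooted path is a copy of an integer interval [-x, y] rooted at 0, and after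
-- reflecting we may take x ≤ y; the pair (x, y) of arm lengths is a complete
-- invariant. The ball of radius s in this path is the interval
-- [-min x s, min y s], and comparing the sizes of the spheres of radius n ≤ s
-- (one or two vertices) shows that, when x ≤ y and x' ≤ y', two such balls are
-- isomorphic exactly when min x s = min x' s and min y s = min y' s. By a case
-- analysis this holds exactly when s ≤ r̃ (x, y, x', y'), so r̃ is the supremum
-- defining ρ.
module Submission where

open import Defs
open import Data.Nat as ℕ using (ℕ; zero; suc; _≤_; _<_; z≤n; s≤s; _∸_; _⊓_; _⊔_)
import Data.Nat.Properties as ℕₚ
open import Data.Nat.DivMod using (_mod_; m≤n⇒m%n≡m)
open import Data.Integer as ℤ using (ℤ; +_; -[1+_]; ∣_∣; _⊖_)
import Data.Integer.Properties as ℤₚ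
open import Data.Fin using (Fin; toℕ; fromℕ<)
import Data.Fin.Properties as Finₚ
open import Data.Product using (Σ; ∃; _×_; _,_; proj₁; proj₂)
open import Data.Sum using (_⊎_; inj₁; inj₂)
open import Data.Bool using (true; false)
open import Data.Empty using (⊥-elim)
open import Function using (_∘_)
open import Relation.Nullary using (¬_; yes; no; Dec)
open import Relation.Binary.PropositionalEquality

≤∞-refl : ∀ {a} → a ≤∞ a
≤∞-refl {fin n} = fin≤fin ℕₚ.≤-refl
≤∞-refl {∞} = ∞ ≤∞∞

0≤∞ : ∀ a → fin 0 ≤∞ a
0≤∞ (fin n) = fin≤fin z≤n
0≤∞ ∞ = fin 0 ≤∞∞

≤∞-trans : ∀ {a b c} → a ≤∞ b → b ≤∞ c → a ≤∞ c
≤∞-trans (fin≤fin p) (fin≤fin q) = fin≤fin (ℕₚ.≤-trans p q)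
≤∞-trans {a} _ (_ ≤∞∞) = a ≤∞∞

≤∞-antisym : ∀ {a b} → a ≤∞ b → b ≤∞ a → a ≡ b
≤∞-antisym (fin≤fin p) (fin≤fin q) = cong fin (ℕₚ.≤-antisym p q)
≤∞-antisym (_ ≤∞∞) (_ ≤∞∞) = refl

≤∞-irrelevant : ∀ {a b} (p q : a ≤∞ b) → p ≡ q
≤∞-irrelevant (fin≤fin p) (fin≤fin q) = cong fin≤fin (ℕₚ.≤-irrelevant p q)
≤∞-irrelevant (_ ≤∞∞) (_ ≤∞∞) = refl

1+n≰∞n : ∀ {n} → ¬ (fin (suc n) ≤∞ fin n)
1+n≰∞n (fin≤fin p) = ℕₚ.<-irrefl refl p

fin-≤∞-or-below : ∀ s a → fin s ≤∞ a ⊎ Σ ℕ λ m → a ≡ fin m × m < s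
fin-≤∞-or-below s (fin m) with s ℕ.≤? m
... | yes s≤m = inj₁ (fin≤fin s≤m)
... | no s≰m = inj₂ (m , refl , ℕₚ.≰⇒> s≰m)
fin-≤∞-or-below s ∞ = inj₁ (fin s ≤∞∞)

≤∞-fromFin : ∀ r u → (∀ s → fin s ≤∞ r → fin s ≤∞ u) → r ≤∞ u
≤∞-fromFin (fin n) u h = h n ≤∞-refl
≤∞-fromFin ∞ (fin m) h = ⊥-elim (1+n≰∞n (h (suc m) (fin (suc m) ≤∞∞)))
≤∞-fromFin ∞ ∞ h = ∞ ≤∞∞

isSup-fromFin : ∀ (P : ℕ → Set) r → (∀ s → P s ⇔ (fin s ≤∞ r)) → IsSup P r
isSup-fromFin P r P⇔ = (λ s → proj₁ (P⇔ s))
                     , (λ u ub → ≤∞-fromFin r u (λ s → ub s ∘ proj₂ (P⇔ s)))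

min∞-≤ˡ : ∀ a b {c} → c ≤∞ min∞ a b → c ≤∞ a
min∞-≤ˡ (fin m) (fin n) (fin≤fin p) = fin≤fin (ℕₚ.≤-trans p (ℕₚ.m⊓n≤m m n))
min∞-≤ˡ (fin m) ∞ p = p
min∞-≤ˡ ∞ b {c} p = c ≤∞∞

min∞-≤ʳ : ∀ a b {c} → c ≤∞ min∞ a b → c ≤∞ b
min∞-≤ʳ (fin m) (fin n) (fin≤fin p) = fin≤fin (ℕₚ.≤-trans p (ℕₚ.m⊓n≤n m n))
min∞-≤ʳ (fin m) ∞ {c} p = c ≤∞∞
min∞-≤ʳ ∞ b p = p

min∞-glb : ∀ a b {c} → c ≤∞ a → c ≤∞ b → c ≤∞ min∞ a b
min∞-glb (fin m) (fin n) (fin≤fin p) (fin≤fin q) = fin≤fin (ℕₚ.⊓-glb p q)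
min∞-glb (fin m) ∞ p q = p
min∞-glb ∞ b p q = q

_≟ℕ∞_ : (a b : ℕ∞) → Dec (a ≡ b)
fin m ≟ℕ∞ fin n with m ℕₚ.≟ n
... | yes refl = yes refl
... | no m≢n = no λ { refl → m≢n refl }
fin m ≟ℕ∞ ∞ = no λ ()
∞ ≟ℕ∞ fin n = no λ ()
∞ ≟ℕ∞ ∞ = yes refl

≟∞-true⇒≡ : ∀ a b → a ≟∞ b ≡ true → a ≡ b
≟∞-true⇒≡ (fin m) (fin n) eq with m ℕₚ.≟ n | eq
... | yes m≡n | _ = cong fin m≡n
... | no _ | ()
≟∞-true⇒≡ ∞ ∞ _ = refl

≟∞-refl : ∀ a → a ≟∞ a ≡ true
≟∞-refl (fin m) with m ℕₚ.≟ m
... | yes _ = refl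
... | no m≢m = ⊥-elim (m≢m refl)
≟∞-refl ∞ = refl

≟∞-false⇒≢ : ∀ a b → a ≟∞ b ≡ false → a ≢ b
≟∞-false⇒≢ a .a eq refl with () ← trans (sym eq) (≟∞-refl a)

-- a ≈[ s ] b says min a s = min b s.

_≤[_]_ : ℕ∞ → ℕ → ℕ∞ → Set
a ≤[ s ] b = ∀ n → n < s → fin (suc n) ≤∞ a → fin (suc n) ≤∞ b

_≈[_]_ : ℕ∞ → ℕ → ℕ∞ → Set
a ≈[ s ] b = a ≤[ s ] b × b ≤[ s ] a

≈[]-refl : ∀ {s} a → a ≈[ s ] a
≈[]-refl a = (λ _ _ p → p) , (λ _ _ p → p)

≈[]-sym : ∀ {s a b} → a ≈[ s ] b → b ≈[ s ] a
≈[]-sym (a≤b , b≤a) = b≤a , a≤b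

≤[]-bounded : ∀ {s a n} → a ≤[ s ] fin n → n < s → a ≤∞ fin n
≤[]-bounded {a = fin m} {n} a≤n n<s with m ℕ.≤? n
... | yes m≤n = fin≤fin m≤n
... | no m≰n = ⊥-elim (1+n≰∞n (a≤n n n<s (fin≤fin (ℕₚ.≰⇒> m≰n))))
≤[]-bounded {a = ∞} {n} a≤n n<s = ⊥-elim (1+n≰∞n (a≤n n n<s (fin (suc n) ≤∞∞)))

≤[]-all⇒≤∞ : ∀ {a b} → (∀ s → a ≤[ s ] b) → a ≤∞ b
≤[]-all⇒≤∞ {b = fin n} a≤b = ≤[]-bounded (a≤b (suc n)) (ℕₚ.n<1+n n)
≤[]-all⇒≤∞ {a} {∞} _ = a ≤∞∞

≈[]-all⇒≡ : ∀ {a b} → (∀ s → a ≈[ s ] b) → a ≡ b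
≈[]-all⇒≡ a≈b = ≤∞-antisym (≤[]-all⇒≤∞ (proj₁ ∘ a≈b)) (≤[]-all⇒≤∞ (proj₂ ∘ a≈b))

≈[]-below⇒≡ : ∀ {s m b} → fin m ≈[ s ] b → m < s → fin m ≡ b
≈[]-below⇒≡ (m≤b , b≤m) m<s with ≤[]-bounded b≤m m<s
... | fin≤fin n≤m = ≤∞-antisym (≤[]-bounded m≤b (ℕₚ.≤-<-trans n≤m m<s)) (fin≤fin n≤m)

≈[]⇒≡⊎≤min : ∀ s a b → a ≈[ s ] b → a ≡ b ⊎ fin s ≤∞ min∞ a b
≈[]⇒≡⊎≤min s a b a≈b with fin-≤∞-or-below s a | fin-≤∞-or-below s b
... | inj₁ s≤a | inj₁ s≤b = inj₂ (min∞-glb a b s≤a s≤b)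
... | inj₂ (m , refl , m<s) | _ = inj₁ (≈[]-below⇒≡ a≈b m<s)
... | inj₁ _ | inj₂ (n , refl , n<s) = inj₁ (sym (≈[]-below⇒≡ (≈[]-sym a≈b) n<s))

≤min⇒≈[] : ∀ {s} a b → fin s ≤∞ min∞ a b → a ≈[ s ] b
≤min⇒≈[] a b s≤ab = (λ n n<s _ → ≤∞-trans (fin≤fin n<s) (min∞-≤ʳ a b s≤ab))
                  , (λ n n<s _ → ≤∞-trans (fin≤fin n<s) (min∞-≤ˡ a b s≤ab))

≈[]-≢⇒≤min : ∀ s a b → a ≈[ s ] b → a ≢ b → fin s ≤∞ min∞ a b
≈[]-≢⇒≤min s a b a≈b a≢b with ≈[]⇒≡⊎≤min s a b a≈b
... | inj₁ a≡b = ⊥-elim (a≢b a≡b)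
... | inj₂ s≤ab = s≤ab

≈[]⇒≤r̃ : ∀ s x y x' y' → x ≈[ s ] x' → y ≈[ s ] y' → fin s ≤∞ r̃ x y x' y'
≈[]⇒≤r̃ s x y x' y' x≈ y≈ with x ≟∞ x' in ex | y ≟∞ y' in ey
... | true | true = fin s ≤∞∞
... | false | true = ≈[]-≢⇒≤min s x x' x≈ (≟∞-false⇒≢ x x' ex)
... | true | false = ≈[]-≢⇒≤min s y y' y≈ (≟∞-false⇒≢ y y' ey)
... | false | false = min∞-glb (min∞ x x') (min∞ y y')
                        (≈[]-≢⇒≤min s x x' x≈ (≟∞-false⇒≢ x x' ex))
                        (≈[]-≢⇒≤min s y y' y≈ (≟∞-false⇒≢ y y' ey))

≤r̃⇒≈[] : ∀ s x y x' y' → fin s ≤∞ r̃ x y x' y' → x ≈[ s ] x' × y ≈[ s ] y'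
≤r̃⇒≈[] s x y x' y' s≤r with x ≟∞ x' in ex | y ≟∞ y' in ey
... | true | true rewrite ≟∞-true⇒≡ x x' ex | ≟∞-true⇒≡ y y' ey = ≈[]-refl x' , ≈[]-refl y'
... | false | true rewrite ≟∞-true⇒≡ y y' ey = ≤min⇒≈[] x x' s≤r , ≈[]-refl y'
... | true | false rewrite ≟∞-true⇒≡ x x' ex = ≈[]-refl x' , ≤min⇒≈[] y y' s≤r
... | false | false = ≤min⇒≈[] x x' (min∞-≤ˡ (min∞ x x') (min∞ y y') s≤r)
                    , ≤min⇒≈[] y y' (min∞-≤ʳ (min∞ x x') (min∞ y y') s≤r)

r̃-refl : ∀ x y → r̃ x y x y ≡ ∞
r̃-refl x y rewrite ≟∞-refl x | ≟∞-refl y = refl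

-- Charts: rooted graphs identified with integer intervals

Consecutive : ℤ → ℤ → Set
Consecutive i j = (i ℤ.+ + 1 ≡ j) ⊎ (j ℤ.+ + 1 ≡ i)

InInterval : ℕ∞ → ℕ∞ → ℤ → Set
InInterval x y (+ n) = fin n ≤∞ y
InInterval x y -[1+ n ] = fin (suc n) ≤∞ x

-- An isomorphism of G with the path on [-x, y] rooted at 0; point is arbitrary
-- outside the interval.
record Chart (G : RGraph) (x y : ℕ∞) : Set where
  field
    coord : V G → ℤ
    point : ℤ → V G
    coord-root : coord (root G) ≡ + 0
    point-coord : ∀ v → point (coord v) ≡ v
    coord-point : ∀ i → InInterval x y i → coord (point i) ≡ i
    coord-inInterval : ∀ v → InInterval x y (coord v)
    adj⇔consecutive : ∀ u v → Adj G u v ⇔ Consecutive (coord u) (coord v)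

InInterval-mono : ∀ {x y x' y'} → x ≤∞ x' → y ≤∞ y' → ∀ i → InInterval x y i → InInterval x' y' i
InInterval-mono x≤x' y≤y' (+ n) p = ≤∞-trans p y≤y'
InInterval-mono x≤x' y≤y' -[1+ n ] p = ≤∞-trans p x≤x'

InInterval-neg : ∀ x y i → InInterval x y i → InInterval y x (ℤ.- i)
InInterval-neg x y (+ zero) _ = 0≤∞ x
InInterval-neg x y (+ suc n) p = p
InInterval-neg x y -[1+ n ] p = p

InInterval-≈[] : ∀ {s x y x' y'} → x ≈[ s ] x' → y ≈[ s ] y' →
                 ∀ i → ∣ i ∣ ≤ s → InInterval x y i → InInterval x' y' i
InInterval-≈[] {y' = y'} _ _ (+ zero) _ _ = 0≤∞ y'
InInterval-≈[] _ (y≤y' , _) (+ suc n) n<s p = y≤y' n n<s p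
InInterval-≈[] (x≤x' , _) _ -[1+ n ] n<s p = x≤x' n n<s p

InInterval⇒∣∣≤ : ∀ {x y} → x ≤∞ y → ∀ i → InInterval x y i → fin ∣ i ∣ ≤∞ y
InInterval⇒∣∣≤ x≤y (+ n) p = p
InInterval⇒∣∣≤ x≤y -[1+ n ] p = ≤∞-trans p x≤y

consecutive⇒∣∣≤ : ∀ i j → Consecutive i j → ∣ j ∣ ≤ suc ∣ i ∣
consecutive⇒∣∣≤ (+ n) _ (inj₁ refl) = ℕₚ.≤-reflexive (ℕₚ.+-comm n 1)
consecutive⇒∣∣≤ -[1+ zero ] _ (inj₁ refl) = z≤n
consecutive⇒∣∣≤ -[1+ suc n ] _ (inj₁ refl) = ℕₚ.m≤n⇒m≤1+n (ℕₚ.n≤1+n (suc n))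
consecutive⇒∣∣≤ _ (+ n) (inj₂ refl) = ℕₚ.m≤n⇒m≤1+n (ℕₚ.m≤m+n n 1)
consecutive⇒∣∣≤ _ -[1+ zero ] (inj₂ refl) = ℕₚ.≤-refl
consecutive⇒∣∣≤ _ -[1+ suc n ] (inj₂ refl) = ℕₚ.≤-refl

-[i+1]+1≡-i : ∀ i → ℤ.- (i ℤ.+ + 1) ℤ.+ + 1 ≡ ℤ.- i
-[i+1]+1≡-i i = begin
  ℤ.- (i ℤ.+ + 1) ℤ.+ + 1       ≡⟨ cong (ℤ._+ + 1) (ℤₚ.neg-distrib-+ i (+ 1)) ⟩
  ℤ.- i ℤ.+ -[1+ 0 ] ℤ.+ + 1    ≡⟨ ℤₚ.+-assoc (ℤ.- i) -[1+ 0 ] (+ 1) ⟩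
  ℤ.- i ℤ.+ + 0                 ≡⟨ ℤₚ.+-identityʳ (ℤ.- i) ⟩
  ℤ.- i                         ∎
  where open ≡-Reasoning

consecutive-neg : ∀ i j → Consecutive i j → Consecutive (ℤ.- i) (ℤ.- j)
consecutive-neg i _ (inj₁ refl) = inj₂ (-[i+1]+1≡-i i)
consecutive-neg _ j (inj₂ refl) = inj₁ (-[i+1]+1≡-i j)

consecutive-neg⁻ : ∀ i j → Consecutive (ℤ.- i) (ℤ.- j) → Consecutive i j
consecutive-neg⁻ i j c =
  subst₂ Consecutive (ℤₚ.neg-involutive i) (ℤₚ.neg-involutive j) (consecutive-neg _ _ c)

reflect : ∀ {G x y} → Chart G x y → Chart G y x
reflect {G} {x} {y} C = record
  { coord = ℤ.-_ ∘ coord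
  ; point = point ∘ ℤ.-_
  ; coord-root = cong ℤ.-_ coord-root
  ; point-coord = λ v → trans (cong point (ℤₚ.neg-involutive (coord v))) (point-coord v)
  ; coord-point = λ i p → trans (cong ℤ.-_ (coord-point (ℤ.- i) (InInterval-neg y x i p)))
                                (ℤₚ.neg-involutive i)
  ; coord-inInterval = λ v → InInterval-neg x y (coord v) (coord-inInterval v)
  ; adj⇔consecutive = λ u v → consecutive-neg _ _ ∘ proj₁ (adj⇔consecutive u v)
                            , proj₂ (adj⇔consecutive u v) ∘ consecutive-neg⁻ _ _
  }
  where open Chart C

walk-snoc : ∀ {G u v w n} → Walk G u v n → Adj G v w → Walk G u w (suc n)
walk-snoc here a = step a here
walk-snoc (step b p) a = step b (walk-snoc p a)

module ChartProperties {G : RGraph} {x y : ℕ∞} (C : Chart G x y) where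
  open Chart C

  point-0 : point (+ 0) ≡ root G
  point-0 = trans (cong point (sym coord-root)) (point-coord (root G))

  coord-injective : ∀ {u v} → coord u ≡ coord v → u ≡ v
  coord-injective {u} {v} eq = trans (sym (point-coord u)) (trans (cong point eq) (point-coord v))

  ∣coord∣-walk : ∀ {u v n} → Walk G u v n → ∣ coord v ∣ ≤ n ℕ.+ ∣ coord u ∣
  ∣coord∣-walk here = ℕₚ.≤-refl
  ∣coord∣-walk {u} {v} {suc n} (step {w = w} a p) = begin
    ∣ coord v ∣                 ≤⟨ ∣coord∣-walk p ⟩
    n ℕ.+ ∣ coord w ∣           ≤⟨ ℕₚ.+-monoʳ-≤ n w-step ⟩
    n ℕ.+ suc ∣ coord u ∣       ≡⟨ ℕₚ.+-suc n ∣ coord u ∣ ⟩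
    suc n ℕ.+ ∣ coord u ∣       ∎
    where
    open ℕₚ.≤-Reasoning
    w-step : ∣ coord w ∣ ≤ suc ∣ coord u ∣
    w-step = consecutive⇒∣∣≤ _ _ (proj₁ (adj⇔consecutive u w) a)

  point-adj : ∀ i j → InInterval x y i → InInterval x y j →
              Consecutive i j → Adj G (point i) (point j)
  point-adj i j pi pj c = proj₂ (adj⇔consecutive (point i) (point j))
    (subst₂ Consecutive (sym (coord-point i pi)) (sym (coord-point j pj)) c)

  walkToPoint : ∀ i → InInterval x y i → Walk G (root G) (point i) ∣ i ∣
  walkToPoint (+ zero) _ = subst (λ v → Walk G (root G) v 0) (sym point-0) here
  walkToPoint (+ suc n) p = walk-snoc (walkToPoint (+ n) p')
    (point-adj (+ n) (+ suc n) p' p (inj₁ (cong +_ (ℕₚ.+-comm n 1))))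
    where p' = ≤∞-trans (fin≤fin (ℕₚ.n≤1+n n)) p
  walkToPoint -[1+ zero ] p = walk-snoc (walkToPoint (+ 0) (0≤∞ y))
    (point-adj (+ 0) -[1+ 0 ] (0≤∞ y) p (inj₂ refl))
  walkToPoint -[1+ suc n ] p = walk-snoc (walkToPoint -[1+ n ] p')
    (point-adj -[1+ n ] -[1+ suc n ] p' p (inj₂ refl))
    where p' = ≤∞-trans (fin≤fin (ℕₚ.n≤1+n (suc n))) p

  within⇔∣coord∣≤ : ∀ s v → Within G s v ⇔ (∣ coord v ∣ ≤ s)
  within⇔∣coord∣≤ s v = to , from
    where
    to : Within G s v → ∣ coord v ∣ ≤ s
    to (n , n≤s , w) = begin
      ∣ coord v ∣                  ≤⟨ ∣coord∣-walk w ⟩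
      n ℕ.+ ∣ coord (root G) ∣     ≡⟨ cong (λ i → n ℕ.+ ∣ i ∣) coord-root ⟩
      n ℕ.+ 0                      ≡⟨ ℕₚ.+-identityʳ n ⟩
      n                            ≤⟨ n≤s ⟩
      s                            ∎
      where open ℕₚ.≤-Reasoning
    from : ∣ coord v ∣ ≤ s → Within G s v
    from le = ∣ coord v ∣ , le , subst (λ w → Walk G (root G) w ∣ coord v ∣) (point-coord v)
                                       (walkToPoint (coord v) (coord-inInterval v))

module Transfer {G H : RGraph} {x y x' y' : ℕ∞} (C : Chart G x y) (C' : Chart H x' y') where
  private
    module C = Chart C
    module C' = Chart C'

  transfer : V G → V H
  transfer = C'.point ∘ C.coord

  coord-transfer : ∀ v → InInterval x' y' (C.coord v) → C'.coord (transfer v) ≡ C.coord v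
  coord-transfer v = C'.coord-point (C.coord v)

  transfer-root : transfer (root G) ≡ root H
  transfer-root = trans (cong C'.point C.coord-root) (ChartProperties.point-0 C')

  transfer-back : ∀ v → InInterval x' y' (C.coord v) → C.point (C'.coord (transfer v)) ≡ v
  transfer-back v p = trans (cong C.point (coord-transfer v p)) (C.point-coord v)

  transfer-adj : ∀ u v → InInterval x' y' (C.coord u) → InInterval x' y' (C.coord v) →
                 Adj G u v ⇔ Adj H (transfer u) (transfer v)
  transfer-adj u v pu pv =
      (λ a → proj₂ (C'.adj⇔consecutive (transfer u) (transfer v))
               (subst₂ Consecutive (sym (coord-transfer u pu)) (sym (coord-transfer v pv))
                 (proj₁ (C.adj⇔consecutive u v) a)))
    , (λ a → proj₂ (C.adj⇔consecutive u v)
               (subst₂ Consecutive (coord-transfer u pu) (coord-transfer v pv)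
                 (proj₁ (C'.adj⇔consecutive (transfer u) (transfer v)) a)))

  transfer-within : ∀ {s} v → Within G s v → InInterval x' y' (C.coord v) → Within H s (transfer v)
  transfer-within {s} v w p = proj₂ (ChartProperties.within⇔∣coord∣≤ C' s (transfer v))
    (subst (λ i → ∣ i ∣ ≤ s) (sym (coord-transfer v p))
      (proj₁ (ChartProperties.within⇔∣coord∣≤ C s v) w))

open Transfer

sameInterval⇒≅ʳ : ∀ {G H x y x' y'} → Chart G x y → Chart H x' y' → x ≡ x' → y ≡ y' → G ≅ʳ H
sameInterval⇒≅ʳ C C' refl refl =
    transfer C C' , transfer C' C
  , (λ v → transfer-back C C' v (coord-inInterval v))
  , (λ w → transfer-back C' C w (Chart.coord-inInterval C' w))
  , transfer-root C C'
  , (λ u v → transfer-adj C C' u v (coord-inInterval u) (coord-inInterval v))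
  where open Chart C

≈[]⇒ballIso : ∀ {G H x y x' y' s} → Chart G x y → Chart H x' y' →
              x ≈[ s ] x' → y ≈[ s ] y' → BallIso s G H
≈[]⇒ballIso {G} {H} {s = s} C C' x≈ y≈ =
    transfer C C' , transfer C' C
  , (λ v w → transfer-within C C' v w (inC' v w))
  , (λ v w → transfer-within C' C v w (inC v w))
  , (λ v w → transfer-back C C' v (inC' v w))
  , (λ v w → transfer-back C' C v (inC v w))
  , transfer-root C C'
  , (λ u v wu wv → transfer-adj C C' u v (inC' u wu) (inC' v wv))
  where
  inC' : ∀ v → Within G s v → InInterval _ _ (Chart.coord C v)
  inC' v w = InInterval-≈[] x≈ y≈ (Chart.coord C v)
    (proj₁ (ChartProperties.within⇔∣coord∣≤ C s v) w) (Chart.coord-inInterval C v)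
  inC : ∀ v → Within H s v → InInterval _ _ (Chart.coord C' v)
  inC v w = InInterval-≈[] (≈[]-sym x≈) (≈[]-sym y≈) (Chart.coord C' v)
    (proj₁ (ChartProperties.within⇔∣coord∣≤ C' s v) w) (Chart.coord-inInterval C' v)

walk-map : ∀ {G H} (f : V G → V H) → (∀ u v → Adj G u v → Adj H (f u) (f v)) →
           ∀ {u v n} → Walk G u v n → Walk H (f u) (f v) n
walk-map f f-adj here = here
walk-map f f-adj (step a p) = step (f-adj _ _ a) (walk-map f f-adj p)

≅ʳ⇒ballIso : ∀ {G H} → G ≅ʳ H → ∀ s → BallIso s G H
≅ʳ⇒ballIso {G} {H} (f , g , gf , fg , f-root , f-adj) s =
  f , g , within-f , within-g , (λ v _ → gf v) , (λ w _ → fg w) , f-root , (λ u v _ _ → f-adj u v)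
  where
  g-adj : ∀ u v → Adj H u v → Adj G (g u) (g v)
  g-adj u v a = proj₂ (f-adj (g u) (g v)) (subst₂ (Adj H) (sym (fg u)) (sym (fg v)) a)
  g-root : g (root H) ≡ root G
  g-root = trans (cong g (sym f-root)) (gf (root G))
  within-f : ∀ v → Within G s v → Within H s (f v)
  within-f v (n , n≤s , w) =
    n , n≤s , subst (λ u → Walk H u (f v) n) f-root (walk-map f (λ u v → proj₁ (f-adj u v)) w)
  within-g : ∀ v → Within H s v → Within G s (g v)
  within-g v (n , n≤s , w) = n , n≤s , subst (λ u → Walk G u (g v) n) g-root (walk-map g g-adj w)

within-root : ∀ {G} s → Within G s (root G)
within-root s = 0 , z≤n , here

ballIso-sym : ∀ {s G H} → BallIso s G H → BallIso s H G
ballIso-sym {s} {G} {H} (f , g , within-f , within-g , gf , fg , f-root , f-adj) =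
  g , f , within-g , within-f , fg , gf , g-root , g-adj
  where
  g-root : g (root H) ≡ root G
  g-root = trans (cong g (sym f-root)) (gf (root G) (within-root s))
  g-adj : ∀ u v → Within H s u → Within H s v → Adj H u v ⇔ Adj G (g u) (g v)
  g-adj u v wu wv with f-adj (g u) (g v) (within-g u wu) (within-g v wv)
  ... | to , from rewrite fg u wu | fg v wv = from , to

-- A ball isomorphism maps every walk from the root inside the ball to a walk,
-- so it preserves the smaller balls.
ballIso-within : ∀ {s k G H} (B : BallIso s G H) → k ≤ s → ∀ v → Within G k v → Within H k (proj₁ B v)
ballIso-within {s} {k} {G} {H} (f , _ , _ , _ , _ , _ , f-root , f-adj) k≤s v (m , m≤k , w) =
  m , m≤k , subst (λ u → Walk H u (f v) m) f-root (go here w (ℕₚ.≤-trans m≤k k≤s))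
  where
  go : ∀ {u v j m} → Walk G (root G) u j → Walk G u v m → j ℕ.+ m ≤ s → Walk H (f u) (f v) m
  go _ here _ = here
  go {u} {_} {j} {suc m} p (step {w = w} a q) j+m≤s =
    step (proj₁ (f-adj u w (j , ℕₚ.≤-trans (ℕₚ.m≤m+n j (suc m)) j+m≤s , p)
                           (suc j , ℕₚ.≤-trans 1+j≤j+[1+m] j+m≤s , walk-snoc p a)) a)
         (go (walk-snoc p a) q (subst (_≤ s) (ℕₚ.+-suc j m) j+m≤s))
    where
    1+j≤j+[1+m] : suc j ≤ j ℕ.+ suc m
    1+j≤j+[1+m] = subst (suc j ≤_) (sym (ℕₚ.+-suc j m)) (s≤s (ℕₚ.m≤m+n j m))

∣∣≡1+n⇒one-is-negative : ∀ {n} i j → ∣ i ∣ ≡ suc n → ∣ j ∣ ≡ suc n → i ≢ j →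
                          i ≡ -[1+ n ] ⊎ j ≡ -[1+ n ]
∣∣≡1+n⇒one-is-negative (+ _) (+ _) refl refl i≢j = ⊥-elim (i≢j refl)
∣∣≡1+n⇒one-is-negative -[1+ _ ] _ refl _ _ = inj₁ refl
∣∣≡1+n⇒one-is-negative (+ _) -[1+ _ ] _ refl _ = inj₂ refl

module BallIsoOfCharts {G H : RGraph} {x y x' y' : ℕ∞} (C : Chart G x y) (C' : Chart H x' y')
                       (x≤y : x ≤∞ y) (x'≤y' : x' ≤∞ y') where
  private
    module C = Chart C
    module C' = Chart C'
    module P = ChartProperties C
    module P' = ChartProperties C'

  module _ {s : ℕ} (B : BallIso s G H) where
    private
      f = proj₁ B
      g = proj₁ (proj₂ B)

      gf : ∀ v → Within G s v → g (f v) ≡ v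
      gf = proj₁ (proj₂ (proj₂ (proj₂ (proj₂ B))))

      ∣coord∣≤⇒within : ∀ {k} v → ∣ C.coord v ∣ ≤ k → Within G k v
      ∣coord∣≤⇒within {k} v = proj₂ (P.within⇔∣coord∣≤ k v)

    ∣coord∣-preserved : ∀ v → ∣ C.coord v ∣ ≤ s → ∣ C'.coord (f v) ∣ ≡ ∣ C.coord v ∣
    ∣coord∣-preserved v v∈B = ℕₚ.≤-antisym image≤ ≤image
      where
      image≤ : ∣ C'.coord (f v) ∣ ≤ ∣ C.coord v ∣
      image≤ = proj₁ (P'.within⇔∣coord∣≤ _ (f v))
                 (ballIso-within B v∈B v (∣coord∣≤⇒within v ℕₚ.≤-refl))
      ≤image : ∣ C.coord v ∣ ≤ ∣ C'.coord (f v) ∣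
      ≤image = proj₁ (P.within⇔∣coord∣≤ _ v)
                 (subst (Within G _) (gf v (∣coord∣≤⇒within v v∈B))
                   (ballIso-within (ballIso-sym B) (ℕₚ.≤-trans image≤ v∈B) (f v)
                     (proj₂ (P'.within⇔∣coord∣≤ _ (f v)) ℕₚ.≤-refl)))

    private
      image : ℤ → ℤ
      image i = C'.coord (f (C.point i))

      ∣image∣ : ∀ i → InInterval x y i → ∣ i ∣ ≤ s → ∣ image i ∣ ≡ ∣ i ∣
      ∣image∣ i p i≤s =
        trans (∣coord∣-preserved (C.point i) (subst (_≤ s) (sym ∣coord∣≡) i≤s)) ∣coord∣≡
        where ∣coord∣≡ = cong ∣_∣ (C.coord-point i p)

      image-injective : ∀ i j → InInterval x y i → InInterval x y j → ∣ i ∣ ≤ s → ∣ j ∣ ≤ s →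
                        image i ≡ image j → i ≡ j
      image-injective i j pi pj i≤s j≤s eq = begin
        i                       ≡⟨ sym (C.coord-point i pi) ⟩
        C.coord (C.point i)     ≡⟨ cong C.coord (sym (gf (C.point i) (inBall i pi i≤s))) ⟩
        C.coord (g (f (C.point i))) ≡⟨ cong (C.coord ∘ g) (P'.coord-injective eq) ⟩
        C.coord (g (f (C.point j))) ≡⟨ cong C.coord (gf (C.point j) (inBall j pj j≤s)) ⟩
        C.coord (C.point j)     ≡⟨ C.coord-point j pj ⟩
        j                       ∎
        where
        open ≡-Reasoning
        inBall : ∀ i → InInterval x y i → ∣ i ∣ ≤ s → Within G s (C.point i)
        inBall i p i≤s =
          ∣coord∣≤⇒within (C.point i) (subst (_≤ s) (sym (cong ∣_∣ (C.coord-point i p))) i≤s)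

    -- The sphere of radius n+1 ≤ s around the root is nonempty iff n+1 ≤ y,
    -- and has two points iff n+1 ≤ x.
    ballIso⇒≤[] : x ≤[ s ] x' × y ≤[ s ] y'
    ballIso⇒≤[] = x≤x' , y≤y'
      where
      y≤y' : y ≤[ s ] y'
      y≤y' n n<s p = subst (λ k → fin k ≤∞ y') (∣image∣ (+ suc n) p n<s)
                       (InInterval⇒∣∣≤ x'≤y' _ (C'.coord-inInterval _))
      x≤x' : x ≤[ s ] x'
      x≤x' n n<s p with ∣∣≡1+n⇒one-is-negative (image (+ suc n)) (image -[1+ n ])
                         (∣image∣ (+ suc n) p⁺ n<s) (∣image∣ -[1+ n ] p n<s)
                         (λ eq → +≢- (image-injective (+ suc n) -[1+ n ] p⁺ p n<s n<s eq))
        where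
        p⁺ = ≤∞-trans p x≤y
        +≢- : + suc n ≢ -[1+ n ]
        +≢- ()
      ... | inj₁ eq = subst (InInterval x' y') eq (C'.coord-inInterval _)
      ... | inj₂ eq = subst (InInterval x' y') eq (C'.coord-inInterval _)

module ChartPair {G H : RGraph} {x y x' y' : ℕ∞} (C : Chart G x y) (C' : Chart H x' y')
                 (x≤y : x ≤∞ y) (x'≤y' : x' ≤∞ y') where

  ballIso⇒≈[] : ∀ {s} → BallIso s G H → x ≈[ s ] x' × y ≈[ s ] y'
  ballIso⇒≈[] B = (proj₁ to , proj₁ from) , (proj₂ to , proj₂ from)
    where
    to = BallIsoOfCharts.ballIso⇒≤[] C C' x≤y x'≤y' B
    from = BallIsoOfCharts.ballIso⇒≤[] C' C x'≤y' x≤y (ballIso-sym B)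

  ballIso⇔≤r̃ : ∀ s → BallIso s G H ⇔ (fin s ≤∞ r̃ x y x' y')
  ballIso⇔≤r̃ s = (λ B → let x≈ , y≈ = ballIso⇒≈[] B in ≈[]⇒≤r̃ s x y x' y' x≈ y≈)
               , (λ s≤r → let x≈ , y≈ = ≤r̃⇒≈[] s x y x' y' s≤r in ≈[]⇒ballIso C C' x≈ y≈)

  ≅ʳ⇒sameInterval : G ≅ʳ H → x ≡ x' × y ≡ y'
  ≅ʳ⇒sameInterval G≅H = ≈[]-all⇒≡ (proj₁ ∘ ≈ₛ) , ≈[]-all⇒≡ (proj₂ ∘ ≈ₛ)
    where
    ≈ₛ : ∀ s → x ≈[ s ] x' × y ≈[ s ] y'
    ≈ₛ s = ballIso⇒≈[] (≅ʳ⇒ballIso G≅H s)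

  distance-≢ : ¬ (x ≡ x' × y ≡ y') → Ρ G H (inv1+ (r̃ x y x' y'))
  distance-≢ ≢ = inj₂ (≢ ∘ ≅ʳ⇒sameInterval , r̃ x y x' y' , isSup-fromFin _ _ ballIso⇔≤r̃ , refl)

  distance : Ρ G H (inv1+ (r̃ x y x' y'))
  distance with x ≟ℕ∞ x' | y ≟ℕ∞ y'
  ... | yes refl | yes refl = inj₁ (sameInterval⇒≅ʳ C C' refl refl , cong inv1+ (r̃-refl x y))
  ... | no x≢x' | _ = distance-≢ (x≢x' ∘ proj₁)
  ... | yes _ | no y≢y' = distance-≢ (y≢y' ∘ proj₂)

-- Inverse of _⊖ a on [-a, ∞).
offset : ℕ → ℤ → ℕ
offset a i = ∣ + a ℤ.+ i ∣

[m+n]⊖m≡n : ∀ m n → (m ℕ.+ n) ⊖ m ≡ + n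
[m+n]⊖m≡n m n = trans (ℤₚ.≤-⊖ (ℕₚ.m≤m+n m n)) (cong +_ (ℕₚ.m+n∸m≡n m n))

offset-⊖ : ∀ a n → offset a (n ⊖ a) ≡ n
offset-⊖ a n = cong ∣_∣ (trans (ℤₚ.distribʳ-⊖-+-pos a n a) ([m+n]⊖m≡n a n))

offset-≤ : ∀ a b i → InInterval (fin a) (fin b) i → offset a i ≤ a ℕ.+ b
offset-≤ a b (+ j) (fin≤fin j≤b) = ℕₚ.+-monoʳ-≤ a j≤b
offset-≤ a b -[1+ j ] (fin≤fin j<a) = begin
  ∣ a ⊖ suc j ∣   ≡⟨ cong ∣_∣ (ℤₚ.≤-⊖ j<a) ⟩
  a ∸ suc j       ≤⟨ ℕₚ.m∸n≤m a (suc j) ⟩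
  a               ≤⟨ ℕₚ.m≤m+n a b ⟩
  a ℕ.+ b         ∎
  where open ℕₚ.≤-Reasoning

⊖-offset : ∀ {y} a i → InInterval (fin a) y i → offset a i ⊖ a ≡ i
⊖-offset a (+ j) _ = [m+n]⊖m≡n a j
⊖-offset a -[1+ j ] (fin≤fin j<a) = begin
  ∣ a ⊖ suc j ∣ ⊖ a         ≡⟨ cong (λ i → ∣ i ∣ ⊖ a) (ℤₚ.≤-⊖ j<a) ⟩
  (a ∸ suc j) ⊖ a           ≡⟨ ℤₚ.⊖-≤ (ℕₚ.m∸n≤m a (suc j)) ⟩
  ℤ.- + (a ∸ (a ∸ suc j))   ≡⟨ cong (ℤ.-_ ∘ +_) (ℕₚ.m∸[m∸n]≡n j<a) ⟩
  -[1+ j ]                  ∎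
  where open ≡-Reasoning

⊖-inInterval : ∀ a n → InInterval (fin a) (fin (n ∸ a)) (n ⊖ a)
⊖-inInterval a n with a ℕ.≤? n
... | yes a≤n = subst (InInterval (fin a) (fin (n ∸ a))) (sym (ℤₚ.≤-⊖ a≤n)) ≤∞-refl
... | no a≰n = subst (InInterval (fin a) (fin (n ∸ a))) (sym (ℤₚ.⊖-≰ a≰n))
                 (InInterval-neg (fin (n ∸ a)) (fin a) (+ (a ∸ n)) (fin≤fin (ℕₚ.m∸n≤m a n)))

1+n⊖a≡n⊖a+1 : ∀ n a → suc n ⊖ a ≡ n ⊖ a ℤ.+ + 1
1+n⊖a≡n⊖a+1 n a = sym (trans (ℤₚ.distribˡ-⊖-+-pos 1 n a) (cong (_⊖ a) (ℕₚ.+-comm n 1)))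

⊖-cancelʳ : ∀ a {n n'} → n ⊖ a ≡ n' ⊖ a → n ≡ n'
⊖-cancelʳ a {n} {n'} eq = trans (sym (offset-⊖ a n)) (trans (cong (offset a) eq) (offset-⊖ a n'))

⊖-consecutive : ∀ a n n' → ((suc n ≡ n') ⊎ (suc n' ≡ n)) ⇔ Consecutive (n ⊖ a) (n' ⊖ a)
⊖-consecutive a n n' = to , from
  where
  to : (suc n ≡ n') ⊎ (suc n' ≡ n) → Consecutive (n ⊖ a) (n' ⊖ a)
  to (inj₁ refl) = inj₁ (sym (1+n⊖a≡n⊖a+1 n a))
  to (inj₂ refl) = inj₂ (sym (1+n⊖a≡n⊖a+1 n' a))
  from : Consecutive (n ⊖ a) (n' ⊖ a) → (suc n ≡ n') ⊎ (suc n' ≡ n)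
  from (inj₁ eq) = inj₁ (⊖-cancelʳ a (trans (1+n⊖a≡n⊖a+1 n a) eq))
  from (inj₂ eq) = inj₂ (⊖-cancelʳ a (trans (1+n⊖a≡n⊖a+1 n' a) eq))

semiChart : ∀ m → Chart (PathSemi m) (fin m) ∞
semiChart m = record
  { coord = _⊖ m
  ; point = offset m
  ; coord-root = ℤₚ.n⊖n≡0 m
  ; point-coord = offset-⊖ m
  ; coord-point = ⊖-offset m
  ; coord-inInterval = λ n → InInterval-mono ≤∞-refl (fin (n ∸ m) ≤∞∞) (n ⊖ m) (⊖-inInterval m n)
  ; adj⇔consecutive = ⊖-consecutive m
  }

toℕ-mod : ∀ {m k} → m ≤ k → toℕ (m mod suc k) ≡ m
toℕ-mod m≤k = trans (Finₚ.toℕ-fromℕ< _) (m≤n⇒m%n≡m m≤k)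

finChart : ∀ k (o : Fin (suc k)) → Chart (PathFin (suc k) o) (fin (toℕ o)) (fin (k ∸ toℕ o))
finChart k o = record
  { coord = λ v → toℕ v ⊖ a
  ; point = λ i → offset a i mod suc k
  ; coord-root = ℤₚ.n⊖n≡0 a
  ; point-coord = point-coord
  ; coord-point = coord-point
  ; coord-inInterval = λ v →
      InInterval-mono ≤∞-refl (fin≤fin (ℕₚ.∸-monoˡ-≤ a (Finₚ.toℕ≤pred[n] v)))
                      (toℕ v ⊖ a) (⊖-inInterval a (toℕ v))
  ; adj⇔consecutive = λ u v → ⊖-consecutive a (toℕ u) (toℕ v)
  }
  where
  a = toℕ o
  a≤k : a ≤ k
  a≤k = Finₚ.toℕ≤pred[n] o
  point-coord : ∀ v → offset a (toℕ v ⊖ a) mod suc k ≡ v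
  point-coord v rewrite offset-⊖ a (toℕ v) = Finₚ.toℕ-injective (toℕ-mod (Finₚ.toℕ≤pred[n] v))
  coord-point : ∀ i → InInterval (fin a) (fin (k ∸ a)) i → toℕ (offset a i mod suc k) ⊖ a ≡ i
  coord-point i p
    rewrite toℕ-mod (subst (offset a i ≤_) (ℕₚ.m+[n∸m]≡n a≤k) (offset-≤ a (k ∸ a) i p)) =
      ⊖-offset a i p

biChart : Chart PathBi ∞ ∞
biChart = record
  { coord = λ i → i
  ; point = λ i → i
  ; coord-root = refl
  ; point-coord = λ _ → refl
  ; coord-point = λ _ _ → refl
  ; coord-inInterval = inInterval
  ; adj⇔consecutive = λ _ _ → (λ c → c) , (λ c → c)
  }
  where
  inInterval : ∀ i → InInterval ∞ ∞ i
  inInterval (+ n) = fin n ≤∞∞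
  inInterval -[1+ n ] = fin (suc n) ≤∞∞

orderedChart : ∀ {G a b} → Chart G (fin a) (fin b) → Chart G (fin (a ⊓ b)) (fin (a ⊔ b))
orderedChart {G} {a} {b} C with a ℕ.≤? b
... | yes a≤b = subst₂ (λ a b → Chart G (fin a) (fin b))
                  (sym (ℕₚ.m≤n⇒m⊓n≡m a≤b)) (sym (ℕₚ.m≤n⇒m⊔n≡n a≤b)) C
... | no a≰b = subst₂ (λ a b → Chart G (fin a) (fin b))
                 (sym (ℕₚ.m≥n⇒m⊓n≡n b≤a)) (sym (ℕₚ.m≥n⇒m⊔n≡m b≤a)) (reflect C)
  where b≤a = ℕₚ.≰⇒≥ a≰b

-- Arm lengths

shortArm : PathCode → ℕ∞
shortArm (finP (suc k) o) = fin (toℕ o ⊓ (k ∸ toℕ o))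
shortArm (semiP m) = fin m
shortArm biP = ∞

longArm : PathCode → ℕ∞
longArm (finP (suc k) o) = fin (toℕ o ⊔ (k ∸ toℕ o))
longArm (semiP m) = ∞
longArm biP = ∞

shortArm≤longArm : ∀ c → shortArm c ≤∞ longArm c
shortArm≤longArm (finP (suc k) o) = fin≤fin (ℕₚ.m⊓n≤m⊔n _ _)
shortArm≤longArm (semiP m) = fin m ≤∞∞
shortArm≤longArm biP = ∞ ≤∞∞

chart : ∀ c → Chart ⟦ c ⟧ (shortArm c) (longArm c)
chart (finP (suc k) o) = orderedChart (finChart k o)
chart (semiP m) = semiChart m
chart biP = biChart

armLengths : PathCode → P̃
armLengths c = (shortArm c , longArm c) , shortArm≤longArm c

P̃-≡ : ∀ {x y x' y'} {p : x ≤∞ y} {p' : x' ≤∞ y'} → x ≡ x' → y ≡ y' →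
      _≡_ {A = P̃} ((x , y) , p) ((x' , y') , p')
P̃-≡ {p = p} {p'} refl refl = cong (_ ,_) (≤∞-irrelevant p p')

armLengths-surjective : ∀ p → ∃ λ c → armLengths c ≡ p
armLengths-surjective ((fin a , fin b) , fin≤fin a≤b) =
  finP (suc (a ℕ.+ b)) o , P̃-≡ (cong fin (trans (cong₂ _⊓_ toℕ-o b-arm) (ℕₚ.m≤n⇒m⊓n≡m a≤b)))
                              (cong fin (trans (cong₂ _⊔_ toℕ-o b-arm) (ℕₚ.m≤n⇒m⊔n≡n a≤b)))
  where
  o : Fin (suc (a ℕ.+ b))
  o = fromℕ< (s≤s (ℕₚ.m≤m+n a b))
  toℕ-o : toℕ o ≡ a
  toℕ-o = Finₚ.toℕ-fromℕ< (s≤s (ℕₚ.m≤m+n a b))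
  b-arm : a ℕ.+ b ∸ toℕ o ≡ b
  b-arm = trans (cong (a ℕ.+ b ∸_) toℕ-o) (ℕₚ.m+n∸m≡n a b)
armLengths-surjective ((fin a , ∞) , _) = semiP a , P̃-≡ refl refl
armLengths-surjective ((∞ , ∞) , _) = biP , P̃-≡ refl refl

mainTheorem18 : Σ (PathCode → P̃) λ f →
      (∀ c c' → (f c ≡ f c') ⇔ (⟦ c ⟧ ≅ʳ ⟦ c' ⟧)) ×
      (∀ p → ∃ λ c → f c ≡ p) ×
      (∀ c c' → Ρ ⟦ c ⟧ ⟦ c' ⟧ (ρ̃ (f c) (f c')))
mainTheorem18 = armLengths , (λ c c' → ≡⇒≅ʳ c c' , ≅ʳ⇒≡ c c') , armLengths-surjective , distance
  where
  distance : ∀ c c' → Ρ ⟦ c ⟧ ⟦ c' ⟧ (ρ̃ (armLengths c) (armLengths c'))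
  distance c c' = ChartPair.distance (chart c) (chart c') (shortArm≤longArm c) (shortArm≤longArm c')
  ≡⇒≅ʳ : ∀ c c' → armLengths c ≡ armLengths c' → ⟦ c ⟧ ≅ʳ ⟦ c' ⟧
  ≡⇒≅ʳ c c' eq =
    sameInterval⇒≅ʳ (chart c) (chart c') (cong (proj₁ ∘ proj₁) eq) (cong (proj₂ ∘ proj₁) eq)
  ≅ʳ⇒≡ : ∀ c c' → ⟦ c ⟧ ≅ʳ ⟦ c' ⟧ → armLengths c ≡ armLengths c'
  ≅ʳ⇒≡ c c' c≅c' = P̃-≡ (proj₁ same) (proj₂ same)
    where
    same = ChartPair.≅ʳ⇒sameInterval (chart c) (chart c') (shortArm≤longArm c) (shortArm≤longArm c') c≅c'
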